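{- Let $n\ge 3$ and let $D_{2n}=\langle a,b: a^n=b^2=e,\ ab=ba^{ -1}\rangle$ be the dihedral group of order $2n$. Then the characteristic polynomial of the distance matrix of the enhanced power graph of $D_{2n}$ is \[ \phi_D(\mathcal{G}_E(D_{2n}),x) = (x+2)^{n-1}(x+1)^{n-2}\big(x^3 - (3n-4)x^2-(2n^2+4n-5)x-n^2-2n+2\big). \]
   Context: For a group $G$, the enhanced power graph $\mathcal{G}_E(G)$ is the simple graph with vertex set $G$ in which distinct $a,b$ are adjacent if and only if $a,b\in\langle c\rangle$ for some $c\in G$. The distance matrix of a connected graph has $(u,v)$-entry equal to the graph distance $d(u,v)$ (and $0$ on the diagonal). $\phi_D(\Gamma,x)=\det(xI-D(\Gamma))$ is the characteristic polynomial of the distance matrix $D(\Gamma)$ of $\Gamma$. -}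

module Defs where

open import Data.Nat as ℕ using (ℕ; zero; suc; NonZero; _≤_)
open import Data.Nat.DivMod using (_mod_)
open import Data.Fin as Fin using (Fin; toℕ; splitAt; punchIn)
open import Data.Sum using (_⊎_; inj₁; inj₂)
open import Data.Product using (Σ; ∃; _×_)
open import Data.Integer as ℤ using (ℤ; +_; -_)
open import Relation.Binary.PropositionalEquality using (_≡_; _≢_)
import Relation.Nullary

-- The dihedral group D_{2n} = ⟨ a, b : a^n = b^2 = e, ab = ba⁻¹ ⟩,
-- concretely: inj₁ i  represents  a^i,   inj₂ i  represents  a^i b
-- (i ∈ ℤ/nℤ, represented by Fin n).

Dih : ℕ → Set
Dih n = Fin n ⊎ Fin n

module _ (n : ℕ) {{nz : NonZero n}} where

  _⊕_ : Fin n → Fin n → Fin n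
  i ⊕ j = (toℕ i ℕ.+ toℕ j) mod n

  _⊖_ : Fin n → Fin n → Fin n
  i ⊖ j = (toℕ i ℕ.+ (n ℕ.∸ toℕ j)) mod n

  dihE : Dih n
  dihE = inj₁ (0 mod n)

  -- multiplication:  a^i a^j = a^(i+j),  a^i (a^j b) = a^(i+j) b,
  --                  (a^i b) a^j = a^(i-j) b,  (a^i b)(a^j b) = a^(i-j)
  dihMul : Dih n → Dih n → Dih n
  dihMul (inj₁ i) (inj₁ j) = inj₁ (i ⊕ j)
  dihMul (inj₁ i) (inj₂ j) = inj₂ (i ⊕ j)
  dihMul (inj₂ i) (inj₁ j) = inj₂ (i ⊖ j)
  dihMul (inj₂ i) (inj₂ j) = inj₁ (i ⊖ j)

  dihPow : Dih n → ℕ → Dih n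
  dihPow c zero    = dihE
  dihPow c (suc k) = dihMul (dihPow c k) c

  -- x ∈ ⟨ c ⟩  (cyclic subgroup generated by c; G finite, so ⟨c⟩ = {c^k : k ∈ ℕ})
  InCyclic : Dih n → Dih n → Set
  InCyclic x c = ∃ λ (k : ℕ) → dihPow c k ≡ x

  EPAdj : Dih n → Dih n → Set
  EPAdj x y = x ≢ y × ∃ λ (c : Dih n) → InCyclic x c × InCyclic y c

  data Walk : Dih n → Dih n → ℕ → Set where
    here  : ∀ {x} → Walk x x 0
    there : ∀ {x y z k} → EPAdj x y → Walk y z k → Walk x z (suc k)

  IsDist : Dih n → Dih n → ℕ → Set
  IsDist x y d = Walk x y d × (∀ k → Walk x y k → d ≤ k)

  elemAt : Fin (n ℕ.+ n) → Dih n
  elemAt = splitAt n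

  IsDistMatrix : (Fin (n ℕ.+ n) → Fin (n ℕ.+ n) → ℕ) → Set
  IsDistMatrix D = ∀ i j → IsDist (elemAt i) (elemAt j) (D i j)

sumFin : ∀ m → (Fin m → ℤ) → ℤ
sumFin zero    f = + 0
sumFin (suc m) f = f Fin.zero ℤ.+ sumFin m (λ i → f (Fin.suc i))

sign : ℕ → ℤ
sign zero    = + 1
sign (suc k) = - sign k

det : ∀ m → (Fin m → Fin m → ℤ) → ℤ
det zero    M = + 1
det (suc m) M = sumFin (suc m) λ j →
  sign (toℕ j) ℤ.* M Fin.zero j ℤ.* det m (λ i k → M (Fin.suc i) (punchIn j k))

xI-D : ∀ m → ℤ → (Fin m → Fin m → ℕ) → Fin m → Fin m → ℤ
xI-D m x D i j with i Fin.≟ j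
... | Relation.Nullary.yes _ = x ℤ.- + D i j
... | Relation.Nullary.no  _ = - (+ D i j)

charPolyAt : ∀ m → (Fin m → Fin m → ℕ) → ℤ → ℤ
charPolyAt m D x = det m (xI-D m x D)

-- In the enhanced power graph of D₂ₙ the identity is adjacent to every element and any two rotations
-- are adjacent (both lie in ⟨a⟩), while a reflection b lies in no cyclic subgroup other than {e, b}.
-- So all distances are 1, except 2 between a reflection and another non-identity element. Listing e
-- first, xI − D is A bordered by −1's, where A has x on the diagonal, −1 between two rotations and −2
-- elsewhere; linearity in the first row and subtracting that row from the others give
-- det (xI − D) = (x + 1) det A − det (A + J), and A + J has the same two-block shape. For two-block
-- matrices, subtracting the second row from the first gives D(s + 2) = 2c D(s + 1) − c² D(s), with c
-- the diagonal minus the off-diagonal entry; the double root c yields closed forms, and the stated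
-- polynomial is a ring identity. Since det is Laplace expansion along the first row, the alternating
-- property behind all row operations comes from expanding along the first two rows, which is
-- antisymmetric in those rows.

module Submission where

open import Data.Empty using (⊥-elim)
open import Data.Bool using (T; true; false; if_then_else_; _∧_)
open import Data.Bool.Properties using (∧-comm; if-float)
open import Data.Fin as Fin using (Fin; zero; suc; toℕ; punchIn; inject₁; join)
open import Data.Fin.Induction using (<-weakInduction)
open import Data.Integer as ℤ using (ℤ; +_; -_; -[1+_]; -1ℤ; _+_; _*_; _-_; _^_)
import Data.Integer.Properties as ℤₚ
open import Data.Integer.Tactic.RingSolver using (solve-∀)
open import Data.Nat as ℕ using (ℕ; zero; suc; NonZero; _≤_; z≤n; s≤s; _<ᵇ_; _≡ᵇ_)
import Data.Fin.Properties as Finₚ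
import Data.Nat.Properties as ℕₚ
open import Data.Nat.DivMod using (_mod_; _%_; m%n<n; m<n⇒m%n≡m; %-distribˡ-+; n%n≡0)
open import Data.Product using (∃; _×_; _,_; proj₁; proj₂)
open import Data.Sum using (_⊎_; inj₁; inj₂)
open import Data.Vec.Functional using (updateAt)
open import Data.Vec.Functional.Properties using (updateAt-updates; updateAt-minimal)
open import Function using (_∘_)
open import Relation.Binary.PropositionalEquality
open import Relation.Nullary using (¬_; does; yes; no)
open import Relation.Nullary.Decidable using (dec-true; dec-false)

open import Defs

open ≡-Reasoning

Matrix : ℕ → Set
Matrix m = Fin m → Fin m → ℤ

minor : ∀ {m} → Matrix (suc m) → Fin (suc m) → Matrix m
minor M j i k = M (suc i) (punchIn j k)

sgn : ∀ {m} → Fin m → ℤ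
sgn j = sign (toℕ j)

laplaceTerm : ∀ {m} → Matrix (suc m) → Fin (suc m) → ℤ
laplaceTerm {m} M j = sgn j * M zero j * det m (minor M j)

sumFin-cong : ∀ m {f g : Fin m → ℤ} → f ≗ g → sumFin m f ≡ sumFin m g
sumFin-cong zero    f≗g = refl
sumFin-cong (suc m) f≗g = cong₂ _+_ (f≗g zero) (sumFin-cong m (f≗g ∘ suc))

sumFin-zero : ∀ m (f : Fin m → ℤ) → (∀ i → f i ≡ + 0) → sumFin m f ≡ + 0
sumFin-zero zero    f f≡0 = refl
sumFin-zero (suc m) f f≡0 = cong₂ _+_ (f≡0 zero) (sumFin-zero m (f ∘ suc) (f≡0 ∘ suc))

sumFin-distrib-+ : ∀ m (f g : Fin m → ℤ) → sumFin m (λ i → f i + g i) ≡ sumFin m f + sumFin m g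
sumFin-distrib-+ zero    f g = refl
sumFin-distrib-+ (suc m) f g = begin
  f zero + g zero + sumFin m (λ i → f (suc i) + g (suc i))
    ≡⟨ cong (_+_ (f zero + g zero)) (sumFin-distrib-+ m (f ∘ suc) (g ∘ suc)) ⟩
  f zero + g zero + (sumFin m (f ∘ suc) + sumFin m (g ∘ suc))
    ≡⟨ interchange (f zero) (g zero) _ _ ⟩
  f zero + sumFin m (f ∘ suc) + (g zero + sumFin m (g ∘ suc)) ∎
  where
  interchange : ∀ a b c d → a + b + (c + d) ≡ a + c + (b + d)
  interchange = solve-∀

*-distribˡ-sumFin : ∀ m c (f : Fin m → ℤ) → sumFin m (λ i → c * f i) ≡ c * sumFin m f
*-distribˡ-sumFin zero    c f = sym (ℤₚ.*-zeroʳ c)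
*-distribˡ-sumFin (suc m) c f =
  trans (cong (_+_ (c * f zero)) (*-distribˡ-sumFin m c (f ∘ suc))) (sym (ℤₚ.*-distribˡ-+ c _ _))

neg-distrib-sumFin : ∀ m (f : Fin m → ℤ) → sumFin m (λ i → - f i) ≡ - sumFin m f
neg-distrib-sumFin zero    f = refl
neg-distrib-sumFin (suc m) f =
  trans (cong (_+_ (- f zero)) (neg-distrib-sumFin m (f ∘ suc))) (sym (ℤₚ.neg-distrib-+ (f zero) _))

sumFin-linear : ∀ m c {f g h : Fin m → ℤ} → (∀ i → f i ≡ g i + c * h i) →
                sumFin m f ≡ sumFin m g + c * sumFin m h
sumFin-linear m c {f} {g} {h} f≡g+ch = begin
  sumFin m f                                 ≡⟨ sumFin-cong m f≡g+ch ⟩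
  sumFin m (λ i → g i + c * h i)             ≡⟨ sumFin-distrib-+ m g (λ i → c * h i) ⟩
  sumFin m g + sumFin m (λ i → c * h i)      ≡⟨ cong (_+_ (sumFin m g)) (*-distribˡ-sumFin m c h) ⟩
  sumFin m g + c * sumFin m h                ∎

det-cong : ∀ m {M N : Matrix m} → (∀ i j → M i j ≡ N i j) → det m M ≡ det m N
det-cong zero    M≡N = refl
det-cong (suc m) M≡N = sumFin-cong (suc m) λ j →
  cong₂ (λ a d → sgn j * a * d) (M≡N zero j) (det-cong m λ i k → M≡N (suc i) (punchIn j k))

det-linear : ∀ m (r : Fin (suc m)) c {M M₁ M₂ : Matrix (suc m)} →
             (∀ j → M r j ≡ M₁ r j + c * M₂ r j) →
             (∀ i → i ≢ r → M i ≗ M₁ i) → (∀ i → i ≢ r → M i ≗ M₂ i) →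
             det (suc m) M ≡ det (suc m) M₁ + c * det (suc m) M₂
det-linear m zero c {M} {M₁} {M₂} row≡ M≗M₁ M≗M₂ =
  sumFin-linear (suc m) c {g = laplaceTerm M₁} {h = laplaceTerm M₂} λ j → begin
  sgn j * M zero j * det m (minor M j)
    ≡⟨ cong (λ a → sgn j * a * det m (minor M j)) (row≡ j) ⟩
  sgn j * (M₁ zero j + c * M₂ zero j) * det m (minor M j)
    ≡⟨ expand (sgn j) (M₁ zero j) c (M₂ zero j) _ ⟩
  sgn j * M₁ zero j * det m (minor M j) + c * (sgn j * M₂ zero j * det m (minor M j))
    ≡⟨ cong₂ (λ d₁ d₂ → sgn j * M₁ zero j * d₁ + c * (sgn j * M₂ zero j * d₂))
             (minor≡ M≗M₁ j) (minor≡ M≗M₂ j) ⟩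
  sgn j * M₁ zero j * det m (minor M₁ j) + c * (sgn j * M₂ zero j * det m (minor M₂ j)) ∎
  where
  expand : ∀ s a c b d → s * (a + c * b) * d ≡ s * a * d + c * (s * b * d)
  expand = solve-∀
  minor≡ : ∀ {N} → (∀ i → i ≢ zero → M i ≗ N i) → ∀ j → det m (minor M j) ≡ det m (minor N j)
  minor≡ M≗N j = det-cong m λ i k → M≗N (suc i) (λ ()) (punchIn j k)
det-linear (suc m) (suc r) c {M} {M₁} {M₂} row≡ M≗M₁ M≗M₂ =
  sumFin-linear (suc (suc m)) c {g = laplaceTerm M₁} {h = laplaceTerm M₂} λ j → begin
  sgn j * M zero j * det (suc m) (minor M j)
    ≡⟨ cong (sgn j * M zero j *_)
            (det-linear m r c (row≡ ∘ punchIn j) (minor≗ M≗M₁ j) (minor≗ M≗M₂ j)) ⟩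
  sgn j * M zero j * (det (suc m) (minor M₁ j) + c * det (suc m) (minor M₂ j))
    ≡⟨ expand (sgn j) (M zero j) _ c _ ⟩
  sgn j * M zero j * det (suc m) (minor M₁ j) + c * (sgn j * M zero j * det (suc m) (minor M₂ j))
    ≡⟨ cong₂ (λ a₁ a₂ → sgn j * a₁ * det (suc m) (minor M₁ j)
                       + c * (sgn j * a₂ * det (suc m) (minor M₂ j)))
             (M≗M₁ zero (λ ()) j) (M≗M₂ zero (λ ()) j) ⟩
  sgn j * M₁ zero j * det (suc m) (minor M₁ j) + c * (sgn j * M₂ zero j * det (suc m) (minor M₂ j)) ∎
  where
  expand : ∀ s a x c y → s * a * (x + c * y) ≡ s * a * x + c * (s * a * y)
  expand = solve-∀
  minor≗ : ∀ {N} → (∀ i → i ≢ suc r → M i ≗ N i) → ∀ j i → i ≢ r → minor M j i ≗ minor N j i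
  minor≗ M≗N j i i≢r k = M≗N (suc i) (i≢r ∘ Finₚ.suc-injective) (punchIn j k)

det-linear₀ : ∀ m c (M M₁ M₂ : Matrix (suc m)) → (∀ j → M zero j ≡ M₁ zero j + c * M₂ zero j) →
              (∀ i → M (suc i) ≗ M₁ (suc i)) → (∀ i → M (suc i) ≗ M₂ (suc i)) →
              det (suc m) M ≡ det (suc m) M₁ + c * det (suc m) M₂
det-linear₀ m c M M₁ M₂ row≡ M≗M₁ M≗M₂ =
  det-linear m zero c row≡ (below M₁ M≗M₁) (below M₂ M≗M₂)
  where
  below : ∀ N → (∀ i → M (suc i) ≗ N (suc i)) → ∀ i → i ≢ zero → M i ≗ N i
  below N M≗N zero    0≢0 = ⊥-elim (0≢0 refl)
  below N M≗N (suc i) _   = M≗N i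

Extensional : ∀ {m n} → ((Fin m → Fin n) → ℤ) → Set
Extensional H = ∀ {f g} → f ≗ g → H f ≡ H g

-- det (2 + m) M reduces to  twoRowExpansion m (M 0) (M 1) (λ f → det m (λ i l → M (2 + i) (f l))).
twoRowExpansion : ∀ m → (u v : Fin (2 ℕ.+ m) → ℤ) → ((Fin m → Fin (2 ℕ.+ m)) → ℤ) → ℤ
twoRowExpansion m u v H = sumFin (2 ℕ.+ m) λ j → sgn j * u j *
  sumFin (suc m) λ k → sgn k * v (punchIn j k) * H (punchIn j ∘ punchIn k)

cofactor₀ : ∀ m → ((Fin m → Fin (2 ℕ.+ m)) → ℤ) → (Fin (2 ℕ.+ m) → ℤ) → ℤ
cofactor₀ m H w = sumFin (suc m) λ j → sgn j * w (suc j) * H (suc ∘ punchIn j)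

twoRowTail : ∀ m → ((Fin m → Fin (2 ℕ.+ m)) → ℤ) → (u v : Fin (2 ℕ.+ m) → ℤ) → ℤ
twoRowTail m H u v = sumFin (suc m) λ j → sgn j * u (suc j) *
  sumFin m λ k → sgn k * v (suc (punchIn j k)) * H (punchIn (suc j) ∘ punchIn (suc k))

twoRowExpansion-unfold : ∀ m u v H →
  twoRowExpansion m u v H ≡ u zero * cofactor₀ m H v - v zero * cofactor₀ m H u + twoRowTail m H u v
twoRowExpansion-unfold m u v H = begin
  + 1 * u zero * cofactor₀ m H v + sumFin (suc m) row
    ≡⟨ cong (_+_ (+ 1 * u zero * cofactor₀ m H v)) (begin
         sumFin (suc m) row
           ≡⟨ sumFin-cong (suc m) row≡ ⟩
         sumFin (suc m) (λ j → - (v zero * cofactorTerm j) + tailTerm j)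
           ≡⟨ sumFin-distrib-+ (suc m) (λ j → - (v zero * cofactorTerm j)) tailTerm ⟩
         sumFin (suc m) (λ j → - (v zero * cofactorTerm j)) + twoRowTail m H u v
           ≡⟨ cong (_+ twoRowTail m H u v)
                   (trans (neg-distrib-sumFin (suc m) (λ j → v zero * cofactorTerm j))
                          (cong -_ (*-distribˡ-sumFin (suc m) (v zero) cofactorTerm))) ⟩
         - (v zero * cofactor₀ m H u) + twoRowTail m H u v ∎) ⟩
  + 1 * u zero * cofactor₀ m H v + (- (v zero * cofactor₀ m H u) + twoRowTail m H u v)
    ≡⟨ regroup (u zero) (cofactor₀ m H v) (v zero) (cofactor₀ m H u) (twoRowTail m H u v) ⟩
  u zero * cofactor₀ m H v - v zero * cofactor₀ m H u + twoRowTail m H u v ∎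
  where
  innerTail : Fin (suc m) → Fin m → ℤ
  innerTail j k = sgn k * v (suc (punchIn j k)) * H (punchIn (suc j) ∘ punchIn (suc k))
  cofactorTerm tailTerm row : Fin (suc m) → ℤ
  cofactorTerm j = sgn j * u (suc j) * H (suc ∘ punchIn j)
  tailTerm j = sgn j * u (suc j) * sumFin m (innerTail j)
  row j = sgn (suc j) * u (suc j) *
    sumFin (suc m) λ k → sgn k * v (punchIn (suc j) k) * H (punchIn (suc j) ∘ punchIn k)

  neg-assoc : ∀ a b c → - a * b * c ≡ - (a * b * c)
  neg-assoc = solve-∀
  split : ∀ s w v₀ h t → - s * w * (+ 1 * v₀ * h + - t) ≡ - (v₀ * (s * w * h)) + s * w * t
  split = solve-∀
  regroup : ∀ u₀ a v₀ b t → + 1 * u₀ * a + (- (v₀ * b) + t) ≡ u₀ * a - v₀ * b + t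
  regroup = solve-∀

  row≡ : ∀ j → row j ≡ - (v zero * cofactorTerm j) + tailTerm j
  row≡ j = begin
    row j
      ≡⟨ cong (λ t → - sgn j * u (suc j) * (+ 1 * v zero * H (suc ∘ punchIn j) + t))
              (trans (sumFin-cong m λ k → neg-assoc (sgn k) _ _) (neg-distrib-sumFin m (innerTail j))) ⟩
    - sgn j * u (suc j) * (+ 1 * v zero * H (suc ∘ punchIn j) + - sumFin m (innerTail j))
      ≡⟨ split (sgn j) (u (suc j)) (v zero) _ _ ⟩
    - (v zero * cofactorTerm j) + tailTerm j ∎

twoRowTail-zero : ∀ H (u v : Fin 2 → ℤ) → twoRowTail 0 H u v ≡ + 0
twoRowTail-zero H u v = sumFin-zero 1 _ λ j → ℤₚ.*-zeroʳ (sgn j * u (suc j))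

twoRowTail≡twoRowExpansion : ∀ m H u v → Extensional H →
  twoRowTail (suc m) H u v ≡ twoRowExpansion m (u ∘ suc) (v ∘ suc) (H ∘ Fin.lift 1)
twoRowTail≡twoRowExpansion m H u v ext = sumFin-cong (2 ℕ.+ m) λ j → cong (sgn j * u (suc j) *_) (
  sumFin-cong (suc m) λ k → cong (sgn k * v (suc (punchIn j k)) *_)
    (ext {punchIn (suc j) ∘ punchIn (suc k)} {Fin.lift 1 (punchIn j ∘ punchIn k)} λ where
    zero    → refl
    (suc l) → refl))

twoRowExpansion-antisym : ∀ m u v H → Extensional H → twoRowExpansion m u v H ≡ - twoRowExpansion m v u H
twoRowExpansion-antisym m u v H ext = begin
  twoRowExpansion m u v H
    ≡⟨ twoRowExpansion-unfold m u v H ⟩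
  u zero * cofactor₀ m H v - v zero * cofactor₀ m H u + twoRowTail m H u v
    ≡⟨ cong (_+_ (u zero * cofactor₀ m H v - v zero * cofactor₀ m H u)) (tail-antisym m H u v ext) ⟩
  u zero * cofactor₀ m H v - v zero * cofactor₀ m H u + - twoRowTail m H v u
    ≡⟨ swap-neg (u zero) (cofactor₀ m H v) (v zero) (cofactor₀ m H u) _ ⟩
  - (v zero * cofactor₀ m H u - u zero * cofactor₀ m H v + twoRowTail m H v u)
    ≡⟨ cong -_ (twoRowExpansion-unfold m v u H) ⟨
  - twoRowExpansion m v u H ∎
  where
  swap-neg : ∀ a b c d t → a * b - c * d + - t ≡ - (c * d - a * b + t)
  swap-neg = solve-∀
  tail-antisym : ∀ m H u v → Extensional H →
                 twoRowTail m H u v ≡ - twoRowTail m H v u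
  tail-antisym zero H u v _ = trans (twoRowTail-zero H u v) (cong -_ (sym (twoRowTail-zero H v u)))
  tail-antisym (suc m) H u v ext = begin
    twoRowTail (suc m) H u v ≡⟨ twoRowTail≡twoRowExpansion m H u v ext ⟩
    twoRowExpansion m (u ∘ suc) (v ∘ suc) (H ∘ Fin.lift 1)
      ≡⟨ twoRowExpansion-antisym m (u ∘ suc) (v ∘ suc) (H ∘ Fin.lift 1) (λ f≗g → ext (lift-cong f≗g)) ⟩
    - twoRowExpansion m (v ∘ suc) (u ∘ suc) (H ∘ Fin.lift 1)
      ≡⟨ cong -_ (twoRowTail≡twoRowExpansion m H v u ext) ⟨
    - twoRowTail (suc m) H v u ∎
    where
    lift-cong : ∀ {f g : Fin m → Fin (2 ℕ.+ m)} → f ≗ g → Fin.lift 1 f ≗ Fin.lift 1 g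
    lift-cong f≗g zero    = refl
    lift-cong f≗g (suc l) = cong suc (f≗g l)

adjacentSwap : ∀ {m} → Fin m → Fin (suc m) → Fin (suc m)
adjacentSwap zero    zero          = suc zero
adjacentSwap zero    (suc zero)    = zero
adjacentSwap zero    (suc (suc i)) = suc (suc i)
adjacentSwap (suc r) zero          = zero
adjacentSwap (suc r) (suc i)       = suc (adjacentSwap r i)

adjacentSwap-inject₁ : ∀ {m} (r : Fin m) → adjacentSwap r (inject₁ r) ≡ suc r
adjacentSwap-inject₁ zero    = refl
adjacentSwap-inject₁ (suc r) = cong suc (adjacentSwap-inject₁ r)

det-adjacentSwap : ∀ m (r : Fin m) (M : Matrix (suc m)) → det (suc m) (M ∘ adjacentSwap r) ≡ - det (suc m) M
det-adjacentSwap (suc m) zero M =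
  twoRowExpansion-antisym m (M (suc zero)) (M zero) (λ f → det m λ i l → M (suc (suc i)) (f l))
    λ f≗g → det-cong m λ i l → cong (M (suc (suc i))) (f≗g l)
det-adjacentSwap (suc m) (suc r) M = begin
  sumFin (2 ℕ.+ m) (λ j → sgn j * M zero j * det (suc m) (minor M j ∘ adjacentSwap r))
    ≡⟨ sumFin-cong (2 ℕ.+ m) (λ j → cong (sgn j * M zero j *_) (det-adjacentSwap m r (minor M j))) ⟩
  sumFin (2 ℕ.+ m) (λ j → sgn j * M zero j * - det (suc m) (minor M j))
    ≡⟨ sumFin-cong (2 ℕ.+ m) (λ j → sym (ℤₚ.neg-distribʳ-* (sgn j * M zero j) (det (suc m) (minor M j)))) ⟩
  sumFin (2 ℕ.+ m) (λ j → - laplaceTerm M j)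
    ≡⟨ neg-distrib-sumFin (2 ℕ.+ m) (laplaceTerm M) ⟩
  - det (2 ℕ.+ m) M ∎

x≡-x⇒x≡0 : ∀ x → x ≡ - x → x ≡ + 0
x≡-x⇒x≡0 x x≡-x = ℤₚ.*-cancelˡ-≡ (+ 2) x (+ 0) (begin
  + 2 * x   ≡⟨ double x ⟩
  x + x     ≡⟨ cong (_+_ x) x≡-x ⟩
  x + - x   ≡⟨ ℤₚ.+-inverseʳ x ⟩
  + 0       ∎)
  where
  double : ∀ x → + 2 * x ≡ x + x
  double = solve-∀

det-equalRows₀₁ : ∀ m (M : Matrix (2 ℕ.+ m)) → M zero ≗ M (suc zero) → det (2 ℕ.+ m) M ≡ + 0
det-equalRows₀₁ m M M₀≗M₁ = x≡-x⇒x≡0 (det (2 ℕ.+ m) M) (begin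
  det (2 ℕ.+ m) M                     ≡⟨ det-cong (2 ℕ.+ m) rows-swapped ⟩
  det (2 ℕ.+ m) (M ∘ adjacentSwap zero) ≡⟨ det-adjacentSwap (suc m) zero M ⟩
  - det (2 ℕ.+ m) M                   ∎)
  where
  rows-swapped : ∀ i j → M i j ≡ M (adjacentSwap zero i) j
  rows-swapped zero          j = M₀≗M₁ j
  rows-swapped (suc zero)    j = sym (M₀≗M₁ j)
  rows-swapped (suc (suc i)) j = refl

det-equalRows₀ : ∀ m (k : Fin m) (M : Matrix (suc m)) → M zero ≗ M (suc k) → det (suc m) M ≡ + 0
det-equalRows₀ (suc m) = <-weakInduction Vanishes (det-equalRows₀₁ m) step
  where
  Vanishes : Fin (suc m) → Set
  Vanishes k = ∀ M → M zero ≗ M (suc k) → det (2 ℕ.+ m) M ≡ + 0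
  -- the swap of rows k + 1 and k + 2 moves the copy of row 0 one step up
  step : ∀ k → Vanishes (inject₁ k) → Vanishes (suc k)
  step k vanishes M M₀≗M₂₊ₖ = begin
    det (2 ℕ.+ m) M                              ≡⟨ ℤₚ.neg-involutive _ ⟨
    - - det (2 ℕ.+ m) M                          ≡⟨ cong -_ (det-adjacentSwap (suc m) (suc k) M) ⟨
    - det (2 ℕ.+ m) (M ∘ adjacentSwap (suc k))   ≡⟨ cong -_ (vanishes (M ∘ adjacentSwap (suc k)) equalRows) ⟩
    - + 0                                        ∎
    where
    equalRows : M zero ≗ M (adjacentSwap (suc k) (suc (inject₁ k)))
    equalRows j = trans (M₀≗M₂₊ₖ j) (cong (λ i → M (suc i) j) (sym (adjacentSwap-inject₁ k)))

det-addRow₀Multiple : ∀ m (k : Fin m) c {M N : Matrix (suc m)} →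
  (∀ j → N (suc k) j ≡ M (suc k) j + c * M zero j) → (∀ i → i ≢ suc k → N i ≗ M i) →
  det (suc m) N ≡ det (suc m) M
det-addRow₀Multiple m k c {M} {N} row≡ N≗M = begin
  det (suc m) N                       ≡⟨ det-linear m (suc k) c row≡′ N≗M N≗M₀ ⟩
  det (suc m) M + c * det (suc m) M₀  ≡⟨ cong (λ d → det (suc m) M + c * d) (det-equalRows₀ m k M₀ M₀-equalRows) ⟩
  det (suc m) M + c * + 0             ≡⟨ cong (_+_ (det (suc m) M)) (ℤₚ.*-zeroʳ c) ⟩
  det (suc m) M + + 0                 ≡⟨ ℤₚ.+-identityʳ _ ⟩
  det (suc m) M                       ∎
  where
  M₀ : Matrix (suc m)
  M₀ = updateAt M (suc k) (λ _ → M zero)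
  M₀-row : M₀ (suc k) ≡ M zero
  M₀-row = updateAt-updates (suc k) M
  M₀-other : ∀ i → i ≢ suc k → M₀ i ≡ M i
  M₀-other i i≢k = updateAt-minimal i (suc k) M i≢k
  row≡′ : ∀ j → N (suc k) j ≡ M (suc k) j + c * M₀ (suc k) j
  row≡′ j = trans (row≡ j) (cong (λ a → M (suc k) j + c * a) (sym (cong-app M₀-row j)))
  N≗M₀ : ∀ i → i ≢ suc k → N i ≗ M₀ i
  N≗M₀ i i≢k j = trans (N≗M i i≢k j) (sym (cong-app (M₀-other i i≢k) j))
  M₀-equalRows : M₀ zero ≗ M₀ (suc k)
  M₀-equalRows j = trans (cong-app (M₀-other zero (λ ())) j) (sym (cong-app M₀-row j))

addRow₀Multiples : ∀ {m} → (Fin m → ℤ) → Matrix (suc m) → Matrix (suc m)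
addRow₀Multiples c M zero    j = M zero j
addRow₀Multiples c M (suc i) j = M (suc i) j + c i * M zero j

det-addRow₀Multiples : ∀ m c (M : Matrix (suc m)) → det (suc m) (addRow₀Multiples c M) ≡ det (suc m) M
det-addRow₀Multiples m c M = begin
  det (suc m) (addRow₀Multiples c M)
    ≡⟨ det-cong (suc m) allRows ⟩
  det (suc m) (addRow₀Multiples (firstCoefficients m) M)
    ≡⟨ firstRowsAdded m ℕₚ.≤-refl ⟩
  det (suc m) M ∎
  where
  firstCoefficients : ℕ → Fin m → ℤ
  firstCoefficients t i = if does (toℕ i ℕ.<? t) then c i else + 0
  firstCoefficients-< : ∀ {t} i → toℕ i ℕ.< t → firstCoefficients t i ≡ c i
  firstCoefficients-< {t} i i<t rewrite dec-true (toℕ i ℕ.<? t) i<t = refl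
  firstCoefficients-≮ : ∀ {t} i → ¬ toℕ i ℕ.< t → firstCoefficients t i ≡ + 0
  firstCoefficients-≮ {t} i i≮t rewrite dec-false (toℕ i ℕ.<? t) i≮t = refl
  allRows : ∀ i j → addRow₀Multiples c M i j ≡ addRow₀Multiples (firstCoefficients m) M i j
  allRows zero    j = refl
  allRows (suc i) j = cong (λ a → M (suc i) j + a * M zero j) (sym (firstCoefficients-< i (Finₚ.toℕ<n i)))

  firstRowsAdded : ∀ t → t ≤ m → det (suc m) (addRow₀Multiples (firstCoefficients t) M) ≡ det (suc m) M
  firstRowsAdded zero _ = det-cong (suc m) {addRow₀Multiples (firstCoefficients 0) M} {M} λ where
    zero    j → refl
    (suc i) j → trans (cong (λ a → M (suc i) j + a * M zero j) (firstCoefficients-≮ {0} i λ ()))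
                      (ℤₚ.+-identityʳ _)
  firstRowsAdded (suc t) t<m =
    trans (det-addRow₀Multiple m k (c k) row≡ others) (firstRowsAdded t (ℕₚ.<⇒≤ t<m))
    where
    k : Fin m
    k = Fin.fromℕ< t<m
    toℕk≡t : toℕ k ≡ t
    toℕk≡t = Finₚ.toℕ-fromℕ< t<m
    row≡ : ∀ j → M (suc k) j + firstCoefficients (suc t) k * M zero j
               ≡ M (suc k) j + firstCoefficients t k * M zero j + c k * M zero j
    row≡ j = begin
      M (suc k) j + firstCoefficients (suc t) k * M zero j
        ≡⟨ cong (λ a → M (suc k) j + a * M zero j)
                (firstCoefficients-< k (s≤s (ℕₚ.≤-reflexive toℕk≡t))) ⟩
      M (suc k) j + c k * M zero j
        ≡⟨ cong (_+ c k * M zero j) (ℤₚ.+-identityʳ (M (suc k) j)) ⟨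
      M (suc k) j + + 0 * M zero j + c k * M zero j
        ≡⟨ cong (λ a → M (suc k) j + a * M zero j + c k * M zero j)
                (firstCoefficients-≮ k (ℕₚ.<-irrefl toℕk≡t)) ⟨
      M (suc k) j + firstCoefficients t k * M zero j + c k * M zero j ∎
    unchanged : ∀ i → toℕ i ≢ t → firstCoefficients (suc t) i ≡ firstCoefficients t i
    unchanged i i≢t with toℕ i ℕ.<? t
    ... | yes i<t = trans (firstCoefficients-< i (ℕₚ.m<n⇒m<1+n i<t)) (sym (firstCoefficients-< i i<t))
    ... | no  i≮t = trans (firstCoefficients-≮ i i≮1+t) (sym (firstCoefficients-≮ i i≮t))
      where
      i≮1+t : ¬ toℕ i ℕ.< suc t
      i≮1+t i<1+t with ℕₚ.m<1+n⇒m<n∨m≡n i<1+t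
      ... | inj₁ i<t = i≮t i<t
      ... | inj₂ i≡t = i≢t i≡t
    others : ∀ i → i ≢ suc k → addRow₀Multiples (firstCoefficients (suc t)) M i
                             ≗ addRow₀Multiples (firstCoefficients t) M i
    others zero    _      j = refl
    others (suc i) i≢1+k j = cong (λ a → M (suc i) j + a * M zero j)
      (unchanged i λ i≡t → i≢1+k (cong suc (Finₚ.toℕ-injective (trans i≡t (sym toℕk≡t)))))

laplaceTerm-zero : ∀ {m} (M : Matrix (suc m)) j → M zero j ≡ + 0 → laplaceTerm M j ≡ + 0
laplaceTerm-zero {m} M j M₀ⱼ≡0 = begin
  sgn j * M zero j * det m (minor M j) ≡⟨ cong (λ a → sgn j * a * det m (minor M j)) M₀ⱼ≡0 ⟩
  sgn j * + 0 * det m (minor M j)      ≡⟨ cong (_* det m (minor M j)) (ℤₚ.*-zeroʳ (sgn j)) ⟩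
  + 0                                  ∎

det-leadingTerm : ∀ m (M : Matrix (suc m)) → sumFin m (laplaceTerm M ∘ suc) ≡ + 0 →
                  det (suc m) M ≡ M zero zero * det m (minor M zero)
det-leadingTerm m M rest≡0 = begin
  + 1 * M zero zero * det m (minor M zero) + sumFin m (laplaceTerm M ∘ suc)
    ≡⟨ cong (_+_ (+ 1 * M zero zero * det m (minor M zero))) rest≡0 ⟩
  + 1 * M zero zero * det m (minor M zero) + + 0
    ≡⟨ simplify (M zero zero) _ ⟩
  M zero zero * det m (minor M zero) ∎
  where
  simplify : ∀ a d → + 1 * a * d + + 0 ≡ a * d
  simplify = solve-∀

det-firstRowSparse : ∀ m (M : Matrix (suc m)) → (∀ j → M zero (suc j) ≡ + 0) →
                     det (suc m) M ≡ M zero zero * det m (minor M zero)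
det-firstRowSparse m M row≡0 =
  det-leadingTerm m M (sumFin-zero m (laplaceTerm M ∘ suc) λ j → laplaceTerm-zero M (suc j) (row≡0 j))

det-firstRowSparse₂ : ∀ m (M : Matrix (2 ℕ.+ m)) → (∀ j → M zero (suc (suc j)) ≡ + 0) →
  det (2 ℕ.+ m) M ≡ M zero zero * det (suc m) (minor M zero) - M zero (suc zero) * det (suc m) (minor M (suc zero))
det-firstRowSparse₂ m M row≡0 = begin
  laplaceTerm M zero + (laplaceTerm M (suc zero) + sumFin m (λ j → laplaceTerm M (suc (suc j))))
    ≡⟨ cong (λ s → laplaceTerm M zero + (laplaceTerm M (suc zero) + s))
            (sumFin-zero m (λ j → laplaceTerm M (suc (suc j))) λ j → laplaceTerm-zero M (suc (suc j)) (row≡0 j)) ⟩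
  laplaceTerm M zero + (laplaceTerm M (suc zero) + + 0)
    ≡⟨ simplify (M zero zero) _ (M zero (suc zero)) _ ⟩
  M zero zero * det (suc m) (minor M zero) - M zero (suc zero) * det (suc m) (minor M (suc zero)) ∎
  where
  simplify : ∀ a d b e → + 1 * a * d + (- + 1 * b * e + + 0) ≡ a * d - b * e
  simplify = solve-∀

det-zeroColumn : ∀ m (M : Matrix (suc m)) → (∀ i → M i zero ≡ + 0) → det (suc m) M ≡ + 0
laplaceTerm-zeroColumn : ∀ m (M : Matrix (2 ℕ.+ m)) j → (∀ i → M (suc i) zero ≡ + 0) →
                         laplaceTerm M (suc j) ≡ + 0

det-zeroColumn zero    M col≡0 = cong (_+ + 0) (laplaceTerm-zero M zero (col≡0 zero))
det-zeroColumn (suc m) M col≡0 = sumFin-zero (2 ℕ.+ m) (laplaceTerm M) λ where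
  zero    → laplaceTerm-zero M zero (col≡0 zero)
  (suc j) → laplaceTerm-zeroColumn m M j (col≡0 ∘ suc)

laplaceTerm-zeroColumn m M j col≡0 = begin
  sgn (suc j) * M zero (suc j) * det (suc m) (minor M (suc j))
    ≡⟨ cong (sgn (suc j) * M zero (suc j) *_) (det-zeroColumn m (minor M (suc j)) col≡0) ⟩
  sgn (suc j) * M zero (suc j) * + 0
    ≡⟨ ℤₚ.*-zeroʳ (sgn (suc j) * M zero (suc j)) ⟩
  + 0 ∎

det-firstColumnSparse : ∀ m (M : Matrix (suc m)) → (∀ i → M (suc i) zero ≡ + 0) →
                        det (suc m) M ≡ M zero zero * det m (minor M zero)
det-firstColumnSparse zero    M _     = det-leadingTerm zero M refl
det-firstColumnSparse (suc m) M col≡0 =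
  det-leadingTerm (suc m) M (sumFin-zero (suc m) (laplaceTerm M ∘ suc) λ j → laplaceTerm-zeroColumn m M j col≡0)

det-topLeft : ∀ m {M N : Matrix (suc m)} →
              (∀ j → M zero (suc j) ≡ N zero (suc j)) → (∀ i → M (suc i) ≗ N (suc i)) →
              det (suc m) M ≡ det (suc m) N + (M zero zero - N zero zero) * det m (minor N zero)
det-topLeft m {M} {N} row≡ M≗N = begin
  det (suc m) M                                          ≡⟨ det-linear₀ m c M N E row-split M≗N M≗N ⟩
  det (suc m) N + c * det (suc m) E                      ≡⟨ cong (λ d → det (suc m) N + c * d) det-E ⟩
  det (suc m) N + c * det m (minor N zero)               ∎
  where
  c : ℤ
  c = M zero zero - N zero zero
  E : Matrix (suc m)
  E zero    zero    = + 1
  E zero    (suc j) = + 0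
  E (suc i) j       = N (suc i) j
  det-E : det (suc m) E ≡ det m (minor N zero)
  det-E = trans (det-firstRowSparse m E λ _ → refl) (ℤₚ.*-identityˡ _)
  row-split : ∀ j → M zero j ≡ N zero j + c * E zero j
  row-split zero    = split (M zero zero) (N zero zero)
    where
    split : ∀ a b → a ≡ b + (a - b) * + 1
    split = solve-∀
  row-split (suc j) =
    trans (row≡ j) (sym (trans (cong (_+_ (N zero (suc j))) (ℤₚ.*-zeroʳ c)) (ℤₚ.+-identityʳ _)))

det-nearlyEqualRows₀₁ : ∀ m (M : Matrix (2 ℕ.+ m)) →
  (∀ j → M zero (suc (suc j)) ≡ M (suc zero) (suc (suc j))) →
  det (2 ℕ.+ m) M ≡ (M zero zero - M (suc zero) zero) * det (suc m) (minor M zero)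
                  - (M zero (suc zero) - M (suc zero) (suc zero)) * det (suc m) (minor M (suc zero))
det-nearlyEqualRows₀₁ m M rows≡ = begin
  det (2 ℕ.+ m) M
    ≡⟨ det-linear₀ (suc m) (+ 1) M M₋ M₌ row-split (λ _ _ → refl) (λ _ _ → refl) ⟩
  det (2 ℕ.+ m) M₋ + + 1 * det (2 ℕ.+ m) M₌
    ≡⟨ cong (λ d → det (2 ℕ.+ m) M₋ + + 1 * d) (det-equalRows₀₁ m M₌ λ _ → refl) ⟩
  det (2 ℕ.+ m) M₋ + + 1 * + 0
    ≡⟨ ℤₚ.+-identityʳ _ ⟩
  det (2 ℕ.+ m) M₋
    ≡⟨ det-firstRowSparse₂ m M₋ (λ j → trans (cong (_- M (suc zero) (suc (suc j))) (rows≡ j))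
                                              (ℤₚ.+-inverseʳ (M (suc zero) (suc (suc j))))) ⟩
  _ ∎
  where
  M₋ M₌ : Matrix (2 ℕ.+ m)
  M₋ zero    j = M zero j - M (suc zero) j
  M₋ (suc i) j = M (suc i) j
  M₌ zero    j = M (suc zero) j
  M₌ (suc i) j = M (suc i) j
  row-split : ∀ j → M zero j ≡ M₋ zero j + + 1 * M₌ zero j
  row-split j = split (M zero j) (M (suc zero) j)
    where
    split : ∀ a b → a ≡ a - b + + 1 * b
    split = solve-∀

border : ∀ {m} → ℤ → Matrix m → Matrix (suc m)
border x A zero    zero    = x
border x A zero    (suc j) = -1ℤ
border x A (suc i) zero    = -1ℤ
border x A (suc i) (suc j) = A i j

det-border : ∀ m x (A : Matrix m) → det (suc m) (border x A) ≡ (x + + 1) * det m A - det m (λ i j → A i j + + 1)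
det-border m x A = begin
  det (suc m) (border x A)
    ≡⟨ det-linear₀ m (+ 1) (border x A) E F row-split (λ _ _ → refl) (λ _ _ → refl) ⟩
  det (suc m) E + + 1 * det (suc m) F
    ≡⟨ cong₂ (λ d e → d + + 1 * e) (det-firstRowSparse m E λ _ → refl) det-F ⟩
  (x + + 1) * det m A + + 1 * (-1ℤ * det m (λ i j → A i j + + 1))
    ≡⟨ simplify (x + + 1) (det m A) _ ⟩
  (x + + 1) * det m A - det m (λ i j → A i j + + 1) ∎
  where
  E F : Matrix (suc m)
  E zero    zero    = x + + 1
  E zero    (suc j) = + 0
  E (suc i) j       = border x A (suc i) j
  F zero    j = -1ℤ
  F (suc i) j = border x A (suc i) j
  row-split : ∀ j → border x A zero j ≡ E zero j + + 1 * F zero j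
  row-split zero    = split x
    where
    split : ∀ x → x ≡ x + + 1 + + 1 * -1ℤ
    split = solve-∀
  row-split (suc j) = refl
  -- subtracting row 0 from the others clears column 0 and adds 1 to every entry of A
  det-F : det (suc m) F ≡ -1ℤ * det m (λ i j → A i j + + 1)
  det-F = trans (sym (det-addRow₀Multiples m (λ _ → -1ℤ) F))
                (det-firstColumnSparse m (addRow₀Multiples (λ _ → -1ℤ) F) λ _ → refl)
  simplify : ∀ a d e → a * d + + 1 * (-1ℤ * e) ≡ a * d - e
  simplify = solve-∀

doubleRoot-closedForm : ∀ c (u : ℕ → ℤ) → (∀ k → u (2 ℕ.+ k) ≡ + 2 * c * u (suc k) - c * c * u k) →
                        ∀ k → u (suc k) ≡ c ^ k * (+ suc k * u 1 - + k * c * u 0)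
doubleRoot-closedForm c u recurrence k = proj₁ (consecutive k)
  where
  closedForm : ℕ → ℤ
  closedForm k = c ^ k * (+ suc k * u 1 - + k * c * u 0)
  base₁ : ∀ c a b → a ≡ + 1 * (+ 1 * a - + 0 * c * b)
  base₁ = solve-∀
  base₂ : ∀ c a b → + 2 * c * a - c * c * b ≡ c * + 1 * (+ 2 * a - + 1 * c * b)
  base₂ = solve-∀
  step : ∀ c P K a b → + 2 * c * (c * P * ((+ 2 + K) * a - (+ 1 + K) * c * b))
                         - c * c * (P * ((+ 1 + K) * a - K * c * b))
                     ≡ c * (c * P) * ((+ 3 + K) * a - (+ 2 + K) * c * b)
  step = solve-∀
  consecutive : ∀ k → u (suc k) ≡ closedForm k × u (2 ℕ.+ k) ≡ closedForm (suc k)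
  consecutive zero    = base₁ c (u 1) (u 0) , trans (recurrence 0) (base₂ c (u 1) (u 0))
  consecutive (suc k) with consecutive k
  ... | uₖ₊₁≡ , uₖ₊₂≡ = uₖ₊₂≡ , (begin
    u (3 ℕ.+ k)
      ≡⟨ recurrence (suc k) ⟩
    + 2 * c * u (2 ℕ.+ k) - c * c * u (suc k)
      ≡⟨ cong₂ (λ v w → + 2 * c * v - c * c * w) uₖ₊₂≡ uₖ₊₁≡ ⟩
    + 2 * c * closedForm (suc k) - c * c * closedForm k
      ≡⟨ step c (c ^ k) (+ k) (u 1) (u 0) ⟩
    closedForm (2 ℕ.+ k) ∎)

-- matrix s t p has diagonal a except the top-left entry t, and off-diagonal entries α inside the
-- leading p × p block, β elsewhere. With a = x, α = −1, β = −2 and p = n − 1 it is xI − D on the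
-- non-identity elements of D₂ₙ.
module TwoBlock (a α β : ℤ) where

  offDiagonal : ℕ → ℕ → ℕ → ℤ
  offDiagonal p i j = if (i <ᵇ p) ∧ (j <ᵇ p) then α else β

  entry : ℤ → ℕ → ℕ → ℕ → ℤ
  entry t p zero    zero    = t
  entry t p (suc i) (suc j) = if i ≡ᵇ j then a else offDiagonal p (suc i) (suc j)
  entry t p i       j       = offDiagonal p i j

  matrix : ∀ s → ℤ → ℕ → Matrix s
  matrix s t p i j = entry t p (toℕ i) (toℕ j)

  D : ℕ → ℕ → ℤ
  D s p = det s (matrix s a p)

  gap : ℕ → ℤ
  gap p = a - offDiagonal p 0 1

  offDiagonal-suc : ∀ p i j → offDiagonal p (suc i) (suc j) ≡ offDiagonal (ℕ.pred p) i j
  offDiagonal-suc zero    i j = refl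
  offDiagonal-suc (suc p) i j = refl

  offDiagonal-sym : ∀ p i j → offDiagonal p i j ≡ offDiagonal p j i
  offDiagonal-sym p i j = cong (if_then α else β) (∧-comm (i <ᵇ p) (j <ᵇ p))

  entry-suc : ∀ t p i j → entry t p (suc i) (suc j) ≡ entry a (ℕ.pred p) i j
  entry-suc t p zero    zero    = refl
  entry-suc t p zero    (suc j) = offDiagonal-suc p 0 (suc j)
  entry-suc t p (suc i) zero    = offDiagonal-suc p (suc i) 0
  entry-suc t p (suc i) (suc j) = cong (if i ≡ᵇ j then a else_) (offDiagonal-suc p (suc i) (suc j))

  entry-skip₁ : ∀ {s} t p i (k : Fin (suc s)) →
    entry t p (suc i) (toℕ (punchIn (suc zero) k)) ≡ entry (offDiagonal p 0 1) (ℕ.pred p) i (toℕ k)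
  entry-skip₁ t p zero zero = offDiagonal-sym p 1 0
  entry-skip₁ t zero          (suc i) zero = refl
  entry-skip₁ t (suc zero)    (suc i) zero = refl
  entry-skip₁ t (suc (suc p)) (suc i) zero = refl
  entry-skip₁ t p zero    (suc k) = offDiagonal-suc p 0 (suc (toℕ k))
  entry-skip₁ t p (suc i) (suc k) = cong (if i ≡ᵇ toℕ k then a else_) (offDiagonal-suc p (suc i) (suc (toℕ k)))

  entry-diagonal : ∀ p i → entry a p i i ≡ a
  entry-diagonal p zero    = refl
  entry-diagonal p (suc i) rewrite dec-true (i ℕ.≟ i) refl = refl

  det-minor₀ : ∀ s t p → det s (minor (matrix (suc s) t p) zero) ≡ D s (ℕ.pred p)
  det-minor₀ s t p = det-cong s λ i k → entry-suc t p (toℕ i) (toℕ k)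

  det-matrix-topLeft : ∀ s t p → det (suc s) (matrix (suc s) t p) ≡ D (suc s) p + (t - a) * D s (ℕ.pred p)
  det-matrix-topLeft s t p = begin
    det (suc s) (matrix (suc s) t p)
      ≡⟨ det-topLeft s {matrix (suc s) t p} {matrix (suc s) a p} (λ _ → refl) sameRows ⟩
    D (suc s) p + (t - a) * det s (minor (matrix (suc s) a p) zero)
      ≡⟨ cong (λ d → D (suc s) p + (t - a) * d) (det-minor₀ s a p) ⟩
    D (suc s) p + (t - a) * D s (ℕ.pred p) ∎
    where
    sameRows : ∀ i → matrix (suc s) t p (suc i) ≗ matrix (suc s) a p (suc i)
    sameRows i zero    = refl
    sameRows i (suc k) = refl

  det-recurrence : ∀ s p →
    D (2 ℕ.+ s) p ≡ + 2 * gap p * D (suc s) (ℕ.pred p) - gap p * gap p * D s (ℕ.pred (ℕ.pred p))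
  det-recurrence s p = begin
    D (2 ℕ.+ s) p
      ≡⟨ det-nearlyEqualRows₀₁ s (matrix (2 ℕ.+ s) a p) (λ j → rows₀₁ p (toℕ j)) ⟩
    (a - offDiagonal p 1 0) * det (suc s) (minor (matrix (2 ℕ.+ s) a p) zero)
      - (o - a) * det (suc s) (minor (matrix (2 ℕ.+ s) a p) (suc zero))
      ≡⟨ cong₂ (λ o′ d → (a - o′) * d - (o - a) * det (suc s) (minor (matrix (2 ℕ.+ s) a p) (suc zero)))
               (offDiagonal-sym p 1 0) (det-minor₀ (suc s) a p) ⟩
    (a - o) * X - (o - a) * det (suc s) (minor (matrix (2 ℕ.+ s) a p) (suc zero))
      ≡⟨ cong (λ d → (a - o) * X - (o - a) * d) (det-cong (suc s) λ i k → entry-skip₁ a p (toℕ i) k) ⟩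
    (a - o) * X - (o - a) * det (suc s) (matrix (suc s) o (ℕ.pred p))
      ≡⟨ cong (λ d → (a - o) * X - (o - a) * d) (det-matrix-topLeft s o (ℕ.pred p)) ⟩
    (a - o) * X - (o - a) * (X + (o - a) * Y)
      ≡⟨ collect a o X Y ⟩
    + 2 * gap p * X - gap p * gap p * Y ∎
    where
    o X Y : ℤ
    o = offDiagonal p 0 1
    X = D (suc s) (ℕ.pred p)
    Y = D s (ℕ.pred (ℕ.pred p))
    rows₀₁ : ∀ p j → entry a p 0 (2 ℕ.+ j) ≡ entry a p 1 (2 ℕ.+ j)
    rows₀₁ zero          j = refl
    rows₀₁ (suc zero)    j = refl
    rows₀₁ (suc (suc p)) j = refl
    collect : ∀ a o X Y → (a - o) * X - (o - a) * (X + (o - a) * Y) ≡ + 2 * (a - o) * X - (a - o) * (a - o) * Y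
    collect = solve-∀

  D-singleton : ∀ p → D 1 p ≡ a
  D-singleton p = simplify a
    where
    simplify : ∀ a → + 1 * a * + 1 + + 0 ≡ a
    simplify = solve-∀

  D-blockSize₁ : ∀ s → D s 1 ≡ D s 0
  D-blockSize₁ s = det-cong s λ i j → sizeOne (toℕ i) (toℕ j)
    where
    sizeOne : ∀ i j → entry a 1 i j ≡ entry a 0 i j
    sizeOne zero    zero    = refl
    sizeOne zero    (suc j) = refl
    sizeOne (suc i) zero    = refl
    sizeOne (suc i) (suc j) = refl

  det-oneBlock : ∀ {e} → a - β ≡ e → ∀ q → D (suc q) 0 ≡ e ^ q * (a + + q * β)
  det-oneBlock refl q = begin
    D (suc q) 0
      ≡⟨ doubleRoot-closedForm (a - β) (λ s → D s 0) (λ s → det-recurrence s 0) q ⟩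
    (a - β) ^ q * (+ suc q * D 1 0 - + q * (a - β) * + 1)
      ≡⟨ cong (λ d → (a - β) ^ q * (+ suc q * d - + q * (a - β) * + 1)) (D-singleton 0) ⟩
    (a - β) ^ q * (+ suc q * a - + q * (a - β) * + 1)
      ≡⟨ cong ((a - β) ^ q *_) (simplify a β (+ q)) ⟩
    (a - β) ^ q * (a + + q * β) ∎
    where
    simplify : ∀ a β K → (+ 1 + K) * a - K * (a - β) * + 1 ≡ a + K * β
    simplify = solve-∀

  -- d and e are abstracted so that callers may supply them in a different normal form.
  det-twoBlocks : ∀ {d e} → a - α ≡ d → a - β ≡ e → ∀ p q →
    D (suc p ℕ.+ suc q) (suc p)
      ≡ d ^ p * (+ suc p * (e ^ suc q * (a + + suc q * β)) - + p * d * (e ^ q * (a + + q * β)))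
  det-twoBlocks {e = e} refl a-β≡e p q = begin
    D (suc p ℕ.+ suc q) (suc p)
      ≡⟨ doubleRoot-closedForm (a - α) (λ k → D (k ℕ.+ suc q) k)
                               (λ k → det-recurrence (k ℕ.+ suc q) (2 ℕ.+ k)) p ⟩
    (a - α) ^ p * (+ suc p * D (2 ℕ.+ q) 1 - + p * (a - α) * D (suc q) 0)
      ≡⟨ cong₂ (λ X Y → (a - α) ^ p * (+ suc p * X - + p * (a - α) * Y))
               (trans (D-blockSize₁ (2 ℕ.+ q)) (det-oneBlock a-β≡e (suc q))) (det-oneBlock a-β≡e q) ⟩
    (a - α) ^ p * (+ suc p * (e ^ suc q * (a + + suc q * β)) - + p * (a - α) * (e ^ q * (a + + q * β))) ∎

twoBlock-+ : ∀ a α β c t p i j →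
  TwoBlock.entry a α β t p i j + c ≡ TwoBlock.entry (a + c) (α + c) (β + c) (t + c) p i j
twoBlock-+ a α β c t p zero    zero    = refl
twoBlock-+ a α β c t p zero    (suc j) = if-float (_+ c) ((0 <ᵇ p) ∧ (suc j <ᵇ p))
twoBlock-+ a α β c t p (suc i) zero    = if-float (_+ c) ((suc i <ᵇ p) ∧ (0 <ᵇ p))
twoBlock-+ a α β c t p (suc i) (suc j) = trans (if-float (_+ c) (i ≡ᵇ j))
  (cong (if i ≡ᵇ j then a + c else_) (if-float (_+ c) ((suc i <ᵇ p) ∧ (suc j <ᵇ p))))

module Dihedral (p : ℕ) where

  n : ℕ
  n = suc p

  e : Dih n
  e = dihE n

  generator : Dih n
  generator = inj₁ (1 mod n)

  toℕ-mod : ∀ (u : Fin n) → toℕ u mod n ≡ u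
  toℕ-mod u = Finₚ.toℕ-injective (trans (Finₚ.toℕ-fromℕ< _) (m<n⇒m%n≡m (Finₚ.toℕ<n u)))

  identityˡ : ∀ y → dihMul n e y ≡ y
  identityˡ (inj₁ u) = cong inj₁ (toℕ-mod u)
  identityˡ (inj₂ u) = cong inj₂ (toℕ-mod u)

  generator-pow : ∀ t → dihPow n generator t ≡ inj₁ (t mod n)
  generator-pow zero    = refl
  generator-pow (suc t) rewrite generator-pow t = cong inj₁ (Finₚ.toℕ-injective (begin
    toℕ ((toℕ (t mod n) ℕ.+ toℕ (1 mod n)) mod n) ≡⟨ Finₚ.toℕ-fromℕ< _ ⟩
    (toℕ (t mod n) ℕ.+ toℕ (1 mod n)) % n         ≡⟨ cong₂ (λ r s → (r ℕ.+ s) % n) (Finₚ.toℕ-fromℕ< (m%n<n t n))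
                                                                                    (Finₚ.toℕ-fromℕ< (m%n<n 1 n)) ⟩
    (t % n ℕ.+ 1 % n) % n                         ≡⟨ %-distribˡ-+ t 1 n ⟨
    (t ℕ.+ 1) % n                                 ≡⟨ cong (_% n) (ℕₚ.+-comm t 1) ⟩
    suc t % n                                     ≡⟨ Finₚ.toℕ-fromℕ< _ ⟨
    toℕ (suc t mod n)                             ∎))

  rotation-inCyclic : ∀ u → InCyclic n (inj₁ u) generator
  rotation-inCyclic u = toℕ u , trans (generator-pow (toℕ u)) (cong inj₁ (toℕ-mod u))

  rotations-adjacent : ∀ {u v} → u ≢ v → EPAdj n (inj₁ u) (inj₁ v)
  rotations-adjacent u≢v = (λ { refl → u≢v refl }) , generator , rotation-inCyclic _ , rotation-inCyclic _

  identity-adjacent : ∀ {y} → y ≢ e → EPAdj n e y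
  identity-adjacent {y} y≢e = y≢e ∘ sym , y , (0 , refl) , (1 , identityˡ y)

  EPAdj-sym : ∀ {x y} → EPAdj n x y → EPAdj n y x
  EPAdj-sym (x≢y , c , x∈⟨c⟩ , y∈⟨c⟩) = x≢y ∘ sym , c , y∈⟨c⟩ , x∈⟨c⟩

  rotation-pow : ∀ u t → ∃ λ v → dihPow n (inj₁ u) t ≡ inj₁ v
  rotation-pow u zero = _ , refl
  rotation-pow u (suc t) with rotation-pow u t
  ... | v , eq rewrite eq = _ , refl

  reflection-square : ∀ u → dihMul n (inj₂ u) (inj₂ u) ≡ e
  reflection-square u = cong inj₁ (Finₚ.toℕ-injective (begin
    toℕ ((toℕ u ℕ.+ (n ℕ.∸ toℕ u)) mod n) ≡⟨ Finₚ.toℕ-fromℕ< _ ⟩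
    (toℕ u ℕ.+ (n ℕ.∸ toℕ u)) % n         ≡⟨ cong (_% n) (ℕₚ.m+[n∸m]≡n (Finₚ.toℕ≤n u)) ⟩
    n % n                                 ≡⟨ n%n≡0 n ⟩
    0                                     ∎))

  reflection-pow : ∀ u t → dihPow n (inj₂ u) t ≡ e ⊎ dihPow n (inj₂ u) t ≡ inj₂ u
  reflection-pow u zero = inj₁ refl
  reflection-pow u (suc t) with reflection-pow u t
  ... | inj₁ eq rewrite eq = inj₂ (identityˡ (inj₂ u))
  ... | inj₂ eq rewrite eq = inj₁ (reflection-square u)

  reflection-inCyclic : ∀ {u c} → InCyclic n (inj₂ u) c → c ≡ inj₂ u
  reflection-inCyclic {u} {inj₁ w} (t , wᵗ≡u) with rotation-pow w t
  ... | v , wᵗ≡v with trans (sym wᵗ≡v) wᵗ≡u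
  ... | ()
  reflection-inCyclic {u} {inj₂ w} (t , wᵗ≡u) with reflection-pow w t
  ... | inj₁ wᵗ≡e with trans (sym wᵗ≡e) wᵗ≡u
  ...   | ()
  reflection-inCyclic {u} {inj₂ w} (t , wᵗ≡u) | inj₂ wᵗ≡w = trans (sym wᵗ≡w) wᵗ≡u

  reflection-neighbour : ∀ {u y} → EPAdj n (inj₂ u) y → y ≡ e
  reflection-neighbour {u} (u≢y , c , u∈⟨c⟩ , (l , cˡ≡y)) with reflection-inCyclic u∈⟨c⟩
  ... | refl with reflection-pow u l
  ...   | inj₁ cˡ≡e = trans (sym cˡ≡y) cˡ≡e
  ...   | inj₂ cˡ≡u = ⊥-elim (u≢y (trans (sym cˡ≡u) cˡ≡y))

  walk₀ : ∀ {x y} → Walk n x y 0 → x ≡ y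
  walk₀ here = refl

  walk₁ : ∀ {x y} → Walk n x y 1 → EPAdj n x y
  walk₁ (there x~y here) = x~y

  isDist-refl : ∀ x → IsDist n x x 0
  isDist-refl x = here , λ _ _ → z≤n

  isDist-adjacent : ∀ {x y} → EPAdj n x y → IsDist n x y 1
  isDist-adjacent x~y@(x≢y , _) = there x~y here , λ where
    zero    w → ⊥-elim (x≢y (walk₀ w))
    (suc _) _ → s≤s z≤n

  isDist-two : ∀ {x y z} → x ≢ y → ¬ EPAdj n x y → EPAdj n x z → EPAdj n z y → IsDist n x y 2
  isDist-two x≢y x≁y x~z z~y = there x~z (there z~y here) , λ where
    zero          w → ⊥-elim (x≢y (walk₀ w))
    (suc zero)    w → ⊥-elim (x≁y (walk₁ w))
    (suc (suc _)) _ → s≤s (s≤s z≤n)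

  isDist-unique : ∀ {x y d d′} → IsDist n x y d → IsDist n x y d′ → d ≡ d′
  isDist-unique (w , min) (w′ , min′) = ℕₚ.≤-antisym (min _ w′) (min′ _ w)

  elemAt-injective : ∀ {i j} → elemAt n i ≡ elemAt n j → i ≡ j
  elemAt-injective {i} {j} eq =
    trans (sym (Finₚ.join-splitAt n n i)) (trans (cong (join n n) eq) (Finₚ.join-splitAt n n j))

  elemAt-nonIdentity : ∀ i → elemAt n (suc i) ≢ e
  elemAt-nonIdentity i eq with elemAt-injective {suc i} {zero} eq
  ... | ()

  elemAt-rotation : ∀ i → (toℕ i <ᵇ p) ≡ true → ∃ λ u → elemAt n (suc i) ≡ inj₁ u
  elemAt-rotation i i<p = _ , Finₚ.splitAt-< n (suc i) (s≤s (ℕₚ.<ᵇ⇒< _ _ (subst T (sym i<p) _)))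

  elemAt-reflection : ∀ i → (toℕ i <ᵇ p) ≡ false → ∃ λ u → elemAt n (suc i) ≡ inj₂ u
  elemAt-reflection i i≮p =
    _ , Finₚ.splitAt-≥ n (suc i) (s≤s (ℕₚ.≮⇒≥ λ i<p → subst T i≮p (ℕₚ.<⇒<ᵇ i<p)))

  -- elemAt lists e, the rotations a, …, aᵖ, then the n reflections.
  distance : ℕ → ℕ → ℕ
  distance zero    zero    = 0
  distance (suc i) (suc j) = if i ≡ᵇ j then 0 else (if (i <ᵇ p) ∧ (j <ᵇ p) then 1 else 2)
  distance i       j       = 1

  distance-self : ∀ i → distance i i ≡ 0
  distance-self zero    = refl
  distance-self (suc i) rewrite dec-true (i ℕ.≟ i) refl = refl

  isDist-rotations : ∀ {i j u v} → i ≢ j → elemAt n i ≡ inj₁ u → elemAt n j ≡ inj₁ v →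
                     IsDist n (elemAt n i) (elemAt n j) 1
  isDist-rotations i≢j eu ev = subst₂ (λ x y → IsDist n x y 1) (sym eu) (sym ev)
    (isDist-adjacent (rotations-adjacent λ u≡v →
      i≢j (elemAt-injective (trans eu (trans (cong inj₁ u≡v) (sym ev))))))

  isDist-viaIdentity : ∀ i j → suc i ≢ suc j → ¬ EPAdj n (elemAt n (suc i)) (elemAt n (suc j)) →
                       IsDist n (elemAt n (suc i)) (elemAt n (suc j)) 2
  isDist-viaIdentity i j i≢j i≁j = isDist-two (i≢j ∘ elemAt-injective) i≁j
    (EPAdj-sym (identity-adjacent (elemAt-nonIdentity i))) (identity-adjacent (elemAt-nonIdentity j))

  isDist-distance : ∀ i j → IsDist n (elemAt n i) (elemAt n j) (distance (toℕ i) (toℕ j))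
  isDist-distance i j with i Fin.≟ j
  ... | yes refl = subst (IsDist n _ _) (sym (distance-self (toℕ i))) (isDist-refl _)
  isDist-distance zero    zero    | no 0≢0 = ⊥-elim (0≢0 refl)
  isDist-distance zero    (suc j) | no _   = isDist-adjacent (identity-adjacent (elemAt-nonIdentity j))
  isDist-distance (suc i) zero    | no _   = isDist-adjacent (EPAdj-sym (identity-adjacent (elemAt-nonIdentity i)))
  isDist-distance (suc i) (suc j) | no i≢j
    rewrite dec-false (toℕ i ℕ.≟ toℕ j) (i≢j ∘ cong suc ∘ Finₚ.toℕ-injective)
    with toℕ i <ᵇ p in i<p | toℕ j <ᵇ p in j<p
  ... | true  | true  = isDist-rotations i≢j (proj₂ (elemAt-rotation i i<p)) (proj₂ (elemAt-rotation j j<p))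
  ... | false | _     = isDist-viaIdentity i j i≢j λ i~j → elemAt-nonIdentity j (reflection-neighbour
                          (subst (λ x → EPAdj n x _) (proj₂ (elemAt-reflection i i<p)) i~j))
  ... | true  | false = isDist-viaIdentity i j i≢j λ i~j → elemAt-nonIdentity i (reflection-neighbour
                          (subst (λ y → EPAdj n y _) (proj₂ (elemAt-reflection j j<p)) (EPAdj-sym i~j)))

module _ (p : ℕ) (x : ℤ) where
  open Dihedral p
  open TwoBlock x -1ℤ (-[1+ 1 ]) using (entry; entry-diagonal; matrix)

  entry≡distance : ∀ a b → a ≢ b → entry x p a b ≡ - + distance (suc a) (suc b)
  entry≡distance zero    zero    0≢0 = ⊥-elim (0≢0 refl)
  entry≡distance zero    (suc b) _   = sym (if-float (-_ ∘ +_) ((0 <ᵇ p) ∧ (suc b <ᵇ p)))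
  entry≡distance (suc a) zero    _   = sym (if-float (-_ ∘ +_) ((suc a <ᵇ p) ∧ (0 <ᵇ p)))
  entry≡distance (suc a) (suc b) a≢b rewrite dec-false (a ℕ.≟ b) (a≢b ∘ cong suc) =
    sym (if-float (-_ ∘ +_) ((suc a <ᵇ p) ∧ (suc b <ᵇ p)))

  border-diagonal : ∀ i → border x (matrix (p ℕ.+ n) x p) i i ≡ x
  border-diagonal zero    = refl
  border-diagonal (suc i) = entry-diagonal p (toℕ i)

  border-offDiagonal : ∀ i j → i ≢ j → border x (matrix (p ℕ.+ n) x p) i j ≡ - + distance (toℕ i) (toℕ j)
  border-offDiagonal zero    zero    0≢0 = ⊥-elim (0≢0 refl)
  border-offDiagonal zero    (suc j) _   = refl
  border-offDiagonal (suc i) zero    _   = refl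
  border-offDiagonal (suc i) (suc j) i≢j =
    entry≡distance (toℕ i) (toℕ j) (i≢j ∘ cong suc ∘ Finₚ.toℕ-injective)

  xI-D≡border : ∀ D → IsDistMatrix n D →
                ∀ i j → xI-D (n ℕ.+ n) x D i j ≡ border x (matrix (p ℕ.+ n) x p) i j
  xI-D≡border D isDistMatrix i j with i Fin.≟ j
  ... | yes refl rewrite isDist-unique (isDistMatrix i i) (isDist-refl _) =
    trans (ℤₚ.+-identityʳ x) (sym (border-diagonal i))
  ... | no i≢j rewrite isDist-unique (isDistMatrix i j) (isDist-distance i j) =
    sym (border-offDiagonal i j i≢j)

-- E, P, K stand for (x + 2)ⁿ⁻¹, (x + 1)ⁿ⁻² and n − 3: the ring solver cannot handle symbolic exponents.
charPoly-identity : ∀ x E P K →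
  (x + + 1) * (P * ((+ 2 + K) * ((x + + 2) * E * (x + (+ 3 + K) * -[1+ 1 ]))
                    - (+ 1 + K) * (x + + 1) * (E * (x + (+ 2 + K) * -[1+ 1 ]))))
  - P * ((+ 2 + K) * ((x + + 2) * E * (x + + 1 + (+ 3 + K) * -1ℤ))
         - (+ 1 + K) * (x + + 1) * (E * (x + + 1 + (+ 2 + K) * -1ℤ)))
  ≡ E * P * (x * (x * (x * + 1)) - (+ 3 * (+ 3 + K) - + 4) * (x * (x * + 1))
             - (+ 2 * ((+ 3 + K) * ((+ 3 + K) * + 1)) + + 4 * (+ 3 + K) - + 5) * x
             - (+ 3 + K) * ((+ 3 + K) * + 1) - + 2 * (+ 3 + K) + + 2)
charPoly-identity = solve-∀

module _ (k : ℕ) (x : ℤ) where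
  private
    p n : ℕ
    p = 2 ℕ.+ k
    n = suc p
    module S = TwoBlock x -1ℤ (-[1+ 1 ])
    module K = TwoBlock (x + + 1) (+ 0) -1ℤ

  charPolyAt-dihedral : ∀ D → IsDistMatrix n D → charPolyAt (n ℕ.+ n) D x
    ≡ (x + + 2) ^ (n ℕ.∸ 1) * (x + + 1) ^ (n ℕ.∸ 2)
      * (x ^ 3 - (+ 3 * + n - + 4) * x ^ 2 - (+ 2 * (+ n) ^ 2 + + 4 * + n - + 5) * x - (+ n) ^ 2 - + 2 * + n + + 2)
  charPolyAt-dihedral D isDistMatrix = begin
    charPolyAt (n ℕ.+ n) D x
      ≡⟨ det-cong (n ℕ.+ n) (xI-D≡border p x D isDistMatrix) ⟩
    det (n ℕ.+ n) (border x (S.matrix (p ℕ.+ n) x p))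
      ≡⟨ det-border (p ℕ.+ n) x (S.matrix (p ℕ.+ n) x p) ⟩
    (x + + 1) * S.D (p ℕ.+ n) p - det (p ℕ.+ n) (λ i j → S.matrix (p ℕ.+ n) x p i j + + 1)
      ≡⟨ cong (_-_ ((x + + 1) * S.D (p ℕ.+ n) p))
              (det-cong (p ℕ.+ n) λ i j → twoBlock-+ x -1ℤ (-[1+ 1 ]) (+ 1) x p (toℕ i) (toℕ j)) ⟩
    (x + + 1) * S.D (p ℕ.+ n) p - K.D (p ℕ.+ n) p
      ≡⟨ cong₂ (λ s t → (x + + 1) * s - t) (S.det-twoBlocks refl refl (suc k) p)
               (K.det-twoBlocks (ℤₚ.+-identityʳ (x + + 1)) (ℤₚ.+-assoc x (+ 1) (+ 1)) (suc k) p) ⟩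
    _ ≡⟨ charPoly-identity x ((x + + 2) ^ p) ((x + + 1) ^ suc k) (+ k) ⟩
    _ ∎

theorem3p3 : (n : ℕ) {{nz : NonZero n}} → 3 ≤ n →
    (∃ λ (D : Fin (n ℕ.+ n) → Fin (n ℕ.+ n) → ℕ) → IsDistMatrix n D)
    × (∀ (D : Fin (n ℕ.+ n) → Fin (n ℕ.+ n) → ℕ) → IsDistMatrix n D →
        ∀ (x : ℤ) → charPolyAt (n ℕ.+ n) D x
          ≡ ((x ℤ.+ + 2) ^ (n ℕ.∸ 1)) ℤ.* ((x ℤ.+ + 1) ^ (n ℕ.∸ 2))
            ℤ.* ((x ^ 3) ℤ.- (+ 3 ℤ.* + n ℤ.- + 4) ℤ.* (x ^ 2)
                 ℤ.- (+ 2 ℤ.* ((+ n) ^ 2) ℤ.+ + 4 ℤ.* + n ℤ.- + 5) ℤ.* x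
                 ℤ.- ((+ n) ^ 2) ℤ.- + 2 ℤ.* + n ℤ.+ + 2))
theorem3p3 (suc (suc (suc k))) (s≤s (s≤s (s≤s z≤n))) =
  ((λ i j → distance (toℕ i) (toℕ j)) , isDist-distance) ,
  λ D isDistMatrix x → charPolyAt-dihedral k x D isDistMatrix
  where open Dihedral (2 ℕ.+ k) using (distance; isDist-distance)
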